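{- Let $(x_n^t)_{n\in\mathbb{Z},\,t\ge 0}$ be the rule 150 elementary cellular automaton started from a single seed ($x_n^0=1$ if $n=0$, $x_n^0=0$ otherwise, and $x_n^{t+1}=(x_{n-1}^t+x_n^t+x_{n+1}^t)\bmod 2$), let $X(t)=\sum_{n\in\mathbb{Z}}x_n^t$, and let $S_n=\sum_{i=0}^{2^n-1}X(i)$. Then for all $n\ge 0$, $$S_n=2^n\,F_{n+2},$$ where $(F_k)$ is the Fibonacci sequence with $F_0=0$, $F_1=1$, $F_k=F_{k-1}+F_{k-2}$. -}

module Defs where

open import Data.Nat using (ℕ; zero; suc; _+_; _*_; _^_)
open import Data.Integer as ℤ using (ℤ; +_; -[1+_])
open import Data.Bool using (Bool; true; false; _xor_; if_then_else_)
open import Data.List using (List; []; _∷_; map; upTo)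
open import Data.Nat.ListAction using (sum)

seed : ℤ → Bool
seed (+ zero) = true
seed _        = false

-- Rule 150: x_n^{t+1} = x_{n-1}^t + x_n^t + x_{n+1}^t (mod 2).
-- Bool with xor is arithmetic mod 2 (true = 1, false = 0).
step : (ℤ → Bool) → (ℤ → Bool)
step x n = x (n ℤ.- + 1) xor x n xor x (n ℤ.+ + 1)

cell : ℕ → ℤ → Bool
cell zero    = seed
cell (suc t) = step (cell t)

bit : Bool → ℕ
bit true  = 1
bit false = 0

windowSum : ℕ → (ℤ → ℕ) → ℕ
windowSum r f = sum (map (λ k → f (+ k ℤ.- + r)) (upTo (suc (r + r))))

-- X(t) = Σ_{n ∈ ℤ} x_n^t.  The configuration at time t is supported in
-- [-t, t] (light cone of radius 1 from the seed), so the sum over ℤ equals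
-- the sum over this window.
X : ℕ → ℕ
X t = windowSum t (λ n → bit (cell t n))

S : ℕ → ℕ
S n = sum (map X (upTo (2 ^ n)))

fib : ℕ → ℕ
fib zero          = 0
fib (suc zero)    = 1
fib (suc (suc k)) = fib (suc k) + fib k

{-# OPTIONS --safe #-}
module Submission where

-- Rule 150 is linear over 𝔽₂ and its square is rule 150 on the even sublattice,
-- so the row at time 2u is the row x at time u spread onto the even cells, and
-- the row at time 2u + 1 carries x m at 2m and x m + x (m + 1) at 2m + 1.
-- With D u the number of m such that x m ≠ x (m + 1), counting gives
-- X (2u) = X u, X (2u + 1) = X u + D u and D (2u) = D (2u + 1) = 2 X u.
-- Summing over dyadic blocks, S (n + 1) = 2 S n + T n and T (n + 1) = 4 S n where
-- T n = Σ_{i < 2ⁿ} D i, so S (n + 2) = 2 S (n + 1) + 4 S n, the recurrence of 2ⁿ F (n + 2).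

open import Defs
open import Data.Nat using (ℕ; _+_; _*_; _^_)
open import Relation.Binary.PropositionalEquality using (_≡_)

open import Algebra.Properties.CommutativeSemigroup using (interchange)
open import Algebra.Solver.Ring.AlmostCommutativeRing using (fromCommutativeRing)
import Algebra.Solver.Ring.Simple as RingSolver
open import Data.Bool using (Bool; false; _xor_)
import Data.Bool as Bool
open import Data.Bool.Properties using (xor-identityʳ; xor-∧-commutativeRing)
open import Data.Integer as ℤ using (ℤ; +_; -[1+_]; +[1+_]; ∣_∣)
open import Data.Integer.Properties using (∣i+j∣≤∣i∣+∣j∣; ∣-i∣≡∣i∣; neg-distrib-+)
  renaming (+-comm to ℤ-+-comm; +-assoc to ℤ-+-assoc; +-identityʳ to ℤ-+-identityʳ)
open import Data.Integer.Tactic.RingSolver using (solve-∀)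
open import Data.List using (applyUpTo; []; _∷_; _∷ʳ_)
open import Data.List.Properties using (map-applyUpTo; applyUpTo-∷ʳ)
open import Data.Nat using (zero; suc; _≤_; _<_)
open import Data.Nat.ListAction using (sum)
open import Data.Nat.ListAction.Properties using (sum-++)
open import Data.Nat.Properties
  using (+-suc; +-comm; +-assoc; +-identityʳ; +-commutativeSemigroup; n<1+n; m<n⇒m<1+n;
         m≤m+n; <-≤-trans; +-cancelˡ-<; <-trans; module ≤-Reasoning)
open import Data.Nat.Tactic.RingSolver using () renaming (solve-∀ to ℕ-solve-∀)
open import Data.Product using (_×_; _,_; proj₁)
open import Function using (_∘_; id)
open import Relation.Binary.PropositionalEquality
  using (refl; sym; trans; cong; cong₂; module ≡-Reasoning)

Σ : ℕ → (ℕ → ℕ) → ℕ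
Σ n f = sum (applyUpTo f n)

Σ-cong : ∀ n {f g : ℕ → ℕ} → (∀ k → f k ≡ g k) → Σ n f ≡ Σ n g
Σ-cong zero    f≗g = refl
Σ-cong (suc n) f≗g = cong₂ _+_ (f≗g 0) (Σ-cong n (f≗g ∘ suc))

Σ-+ : ∀ n (f g : ℕ → ℕ) → Σ n (λ k → f k + g k) ≡ Σ n f + Σ n g
Σ-+ zero    f g = refl
Σ-+ (suc n) f g =
  trans (cong (_+_ (f 0 + g 0)) (Σ-+ n (f ∘ suc) (g ∘ suc))) (interchange +-commutativeSemigroup (f 0) (g 0) _ _)

Σ-last : ∀ n (f : ℕ → ℕ) → Σ (suc n) f ≡ Σ n f + f n
Σ-last n f = begin
  Σ (suc n) f                ≡⟨ cong sum (applyUpTo-∷ʳ f n) ⟨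
  sum (applyUpTo f n ∷ʳ f n) ≡⟨ sum-++ (applyUpTo f n) (f n ∷ []) ⟩
  Σ n f + (f n + 0)          ≡⟨ cong (_+_ (Σ n f)) (+-identityʳ (f n)) ⟩
  Σ n f + f n                ∎
  where open ≡-Reasoning

Σ-pairs : ∀ n (f : ℕ → ℕ) → Σ (n + n) f ≡ Σ n (λ k → f (k + k) + f (suc (k + k)))
Σ-pairs zero    f = refl
Σ-pairs (suc n) f = begin
  Σ (suc n + suc n) f
    ≡⟨ cong (λ m → Σ (suc m) f) (+-suc n n) ⟩
  f 0 + (f 1 + Σ (n + n) (f ∘ suc ∘ suc))
    ≡⟨ +-assoc (f 0) (f 1) _ ⟨
  f 0 + f 1 + Σ (n + n) (f ∘ suc ∘ suc)
    ≡⟨ cong (_+_ (f 0 + f 1)) (Σ-pairs n (f ∘ suc ∘ suc)) ⟩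
  f 0 + f 1 + Σ n (λ k → f (suc (suc (k + k))) + f (suc (suc (suc (k + k)))))
    ≡⟨ cong (_+_ (f 0 + f 1)) (Σ-cong n λ k → cong (λ m → f m + f (suc m)) (+-suc (suc k) k)) ⟨
  Σ (suc n) (λ k → f (k + k) + f (suc (k + k))) ∎
  where open ≡-Reasoning

Σℤ : ℤ → ℕ → (ℤ → ℕ) → ℕ
Σℤ a n f = Σ n (λ k → f (a ℤ.+ + k))

Σℤ-cong : ∀ a n {f g : ℤ → ℕ} → (∀ m → f m ≡ g m) → Σℤ a n f ≡ Σℤ a n g
Σℤ-cong a n f≗g = Σ-cong n (λ k → f≗g (a ℤ.+ + k))

Σℤ-+ : ∀ a n (f g : ℤ → ℕ) → Σℤ a n (λ m → f m + g m) ≡ Σℤ a n f + Σℤ a n g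
Σℤ-+ a n f g = Σ-+ n (λ k → f (a ℤ.+ + k)) (λ k → g (a ℤ.+ + k))

Σℤ-suc : ∀ a n (f : ℤ → ℕ) → Σℤ a (suc n) f ≡ f a + Σℤ (a ℤ.+ + 1) n f
Σℤ-suc a n f = cong₂ _+_ (cong f (ℤ-+-identityʳ a)) (Σ-cong n λ k → cong f (sym (ℤ-+-assoc a (+ 1) (+ k))))

Σℤ-last : ∀ a n (f : ℤ → ℕ) → Σℤ a (suc n) f ≡ Σℤ a n f + f (a ℤ.+ + n)
Σℤ-last a n f = Σ-last n (λ k → f (a ℤ.+ + k))

Σℤ-shift : ∀ a n (f : ℤ → ℕ) → Σℤ a n (λ m → f (m ℤ.+ + 1)) ≡ Σℤ (a ℤ.+ + 1) n f
Σℤ-shift a n f = Σ-cong n λ k → cong f (a+k+1≡a+1+k a (+ k))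
  where
  a+k+1≡a+1+k : ∀ a k → a ℤ.+ k ℤ.+ + 1 ≡ a ℤ.+ + 1 ℤ.+ k
  a+k+1≡a+1+k = solve-∀

Σℤ-slide : ∀ a n (f : ℤ → ℕ) → f a + Σℤ a n (λ m → f (m ℤ.+ + 1)) ≡ Σℤ a n f + f (a ℤ.+ + n)
Σℤ-slide a n f = begin
  f a + Σℤ a n (λ m → f (m ℤ.+ + 1)) ≡⟨ cong (_+_ (f a)) (Σℤ-shift a n f) ⟩
  f a + Σℤ (a ℤ.+ + 1) n f           ≡⟨ Σℤ-suc a n f ⟨
  Σℤ a (suc n) f                     ≡⟨ Σℤ-last a n f ⟩
  Σℤ a n f + f (a ℤ.+ + n)           ∎
  where open ≡-Reasoning

Σℤ-pairs : ∀ a n (f : ℤ → ℕ) →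
           Σℤ (a ℤ.+ a) (n + n) f ≡ Σℤ a n (λ m → f (m ℤ.+ m) + f (m ℤ.+ m ℤ.+ + 1))
Σℤ-pairs a n f = trans (Σ-pairs n (λ k → f (a ℤ.+ a ℤ.+ + k)))
  (Σ-cong n λ k → cong₂ (λ i j → f i + f j) (even a (+ k)) (odd a (+ k)))
  where
  even : ∀ a k → a ℤ.+ a ℤ.+ (k ℤ.+ k) ≡ (a ℤ.+ k) ℤ.+ (a ℤ.+ k)
  even = solve-∀
  odd : ∀ a k → a ℤ.+ a ℤ.+ (+ 1 ℤ.+ (k ℤ.+ k)) ≡ (a ℤ.+ k) ℤ.+ (a ℤ.+ k) ℤ.+ + 1
  odd = solve-∀

windowSum≡Σℤ : ∀ r (f : ℤ → ℕ) → windowSum r f ≡ Σℤ (ℤ.- + r) (suc (r + r)) f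
windowSum≡Σℤ r f = trans (cong sum (map-applyUpTo id (λ k → f (+ k ℤ.- + r)) (suc (r + r))))
  (Σ-cong (suc (r + r)) λ k → cong f (ℤ-+-comm (+ k) (ℤ.- + r)))

module 𝔽₂ = RingSolver (fromCommutativeRing xor-∧-commutativeRing) Bool._≟_

Δ : (ℤ → Bool) → (ℤ → Bool)
Δ x m = x m xor x (m ℤ.+ + 1)

-- Over 𝔽₂ the square of 1 + z + z⁻¹ is 1 + z² + z⁻².
step∘step : ∀ x n → step (step x) n ≡ x (n ℤ.- + 2) xor x n xor x (n ℤ.+ + 2)
step∘step x n = begin
  step (step x) n
    ≡⟨ cong₂ (λ l r → l xor step x n xor r) left right ⟩
  (x (n ℤ.- + 2) xor x (n ℤ.- + 1) xor x n) xor step x n xor (x n xor x (n ℤ.+ + 1) xor x (n ℤ.+ + 2))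
    ≡⟨ frobenius (x (n ℤ.- + 2)) (x (n ℤ.- + 1)) (x n) (x (n ℤ.+ + 1)) (x (n ℤ.+ + 2)) ⟩
  x (n ℤ.- + 2) xor x n xor x (n ℤ.+ + 2) ∎
  where
  open ≡-Reasoning
  left : step x (n ℤ.- + 1) ≡ x (n ℤ.- + 2) xor x (n ℤ.- + 1) xor x n
  left = cong₂ (λ i j → x i xor x (n ℤ.- + 1) xor x j) (n-1-1≡n-2 n) (n-1+1≡n n)
    where
    n-1-1≡n-2 : ∀ n → n ℤ.- + 1 ℤ.- + 1 ≡ n ℤ.- + 2
    n-1-1≡n-2 = solve-∀
    n-1+1≡n : ∀ n → n ℤ.- + 1 ℤ.+ + 1 ≡ n
    n-1+1≡n = solve-∀
  right : step x (n ℤ.+ + 1) ≡ x n xor x (n ℤ.+ + 1) xor x (n ℤ.+ + 2)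
  right = cong₂ (λ i j → x i xor x (n ℤ.+ + 1) xor x j) (n+1-1≡n n) (n+1+1≡n+2 n)
    where
    n+1-1≡n : ∀ n → n ℤ.+ + 1 ℤ.- + 1 ≡ n
    n+1-1≡n = solve-∀
    n+1+1≡n+2 : ∀ n → n ℤ.+ + 1 ℤ.+ + 1 ≡ n ℤ.+ + 2
    n+1+1≡n+2 = solve-∀
  frobenius : ∀ a b c d e → (a xor b xor c) xor (b xor c xor d) xor (c xor d xor e) ≡ a xor c xor e
  frobenius = solve 5 (λ a b c d e → (a :+ (b :+ c)) :+ ((b :+ (c :+ d)) :+ (c :+ (d :+ e)))
                                   := a :+ (c :+ e)) refl
    where open 𝔽₂

record IsDilation (y x : ℤ → Bool) : Set where
  field
    even : ∀ m → y (m ℤ.+ m) ≡ x m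
    odd  : ∀ m → y (m ℤ.+ m ℤ.+ + 1) ≡ false

private
  2m-1≡2[m-1]+1 : ∀ m → m ℤ.+ m ℤ.- + 1 ≡ (m ℤ.- + 1) ℤ.+ (m ℤ.- + 1) ℤ.+ + 1
  2m-1≡2[m-1]+1 = solve-∀
  2m+1-1≡2m : ∀ m → m ℤ.+ m ℤ.+ + 1 ℤ.- + 1 ≡ m ℤ.+ m
  2m+1-1≡2m = solve-∀
  2m+1+1≡2[m+1] : ∀ m → m ℤ.+ m ℤ.+ + 1 ℤ.+ + 1 ≡ (m ℤ.+ + 1) ℤ.+ (m ℤ.+ + 1)
  2m+1+1≡2[m+1] = solve-∀
  2m-2≡2[m-1] : ∀ m → m ℤ.+ m ℤ.- + 2 ≡ (m ℤ.- + 1) ℤ.+ (m ℤ.- + 1)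
  2m-2≡2[m-1] = solve-∀
  2m+2≡2[m+1] : ∀ m → m ℤ.+ m ℤ.+ + 2 ≡ (m ℤ.+ + 1) ℤ.+ (m ℤ.+ + 1)
  2m+2≡2[m+1] = solve-∀
  2m+1-2≡2[m-1]+1 : ∀ m → m ℤ.+ m ℤ.+ + 1 ℤ.- + 2 ≡ (m ℤ.- + 1) ℤ.+ (m ℤ.- + 1) ℤ.+ + 1
  2m+1-2≡2[m-1]+1 = solve-∀
  2m+1+2≡2[m+1]+1 : ∀ m → m ℤ.+ m ℤ.+ + 1 ℤ.+ + 2 ≡ (m ℤ.+ + 1) ℤ.+ (m ℤ.+ + 1) ℤ.+ + 1
  2m+1+2≡2[m+1]+1 = solve-∀

module _ {y x : ℤ → Bool} (dil : IsDilation y x) where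
  open IsDilation dil

  step²-dilation : IsDilation (step (step y)) (step x)
  step²-dilation = record
    { even = λ m → trans (step∘step y (m ℤ.+ m))
        (cong₂ _xor_ (trans (cong y (2m-2≡2[m-1] m)) (even (m ℤ.- + 1)))
          (cong₂ _xor_ (even m) (trans (cong y (2m+2≡2[m+1] m)) (even (m ℤ.+ + 1)))))
    ; odd  = λ m → trans (step∘step y (m ℤ.+ m ℤ.+ + 1))
        (cong₂ _xor_ (trans (cong y (2m+1-2≡2[m-1]+1 m)) (odd (m ℤ.- + 1)))
          (cong₂ _xor_ (odd m) (trans (cong y (2m+1+2≡2[m+1]+1 m)) (odd (m ℤ.+ + 1)))))
    }

  step-even : ∀ m → step y (m ℤ.+ m) ≡ x m
  step-even m = trans
    (cong₂ _xor_ (trans (cong y (2m-1≡2[m-1]+1 m)) (odd (m ℤ.- + 1))) (cong₂ _xor_ (even m) (odd m)))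
    (xor-identityʳ (x m))

  step-odd : ∀ m → step y (m ℤ.+ m ℤ.+ + 1) ≡ Δ x m
  step-odd m =
    cong₂ _xor_ (trans (cong y (2m+1-1≡2m m)) (even m))
      (cong₂ _xor_ (odd m) (trans (cong y (2m+1+1≡2[m+1] m)) (even (m ℤ.+ + 1))))

  Δ-even : ∀ m → Δ y (m ℤ.+ m) ≡ x m
  Δ-even m = trans (cong₂ _xor_ (even m) (odd m)) (xor-identityʳ (x m))

  Δ-odd : ∀ m → Δ y (m ℤ.+ m ℤ.+ + 1) ≡ x (m ℤ.+ + 1)
  Δ-odd m = cong₂ _xor_ (odd m) (trans (cong y (2m+1+1≡2[m+1] m)) (even (m ℤ.+ + 1)))

  Δ∘step-even : ∀ m → Δ (step y) (m ℤ.+ m) ≡ x (m ℤ.+ + 1)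
  Δ∘step-even m = trans (cong₂ _xor_ (step-even m) (step-odd m)) (a+[a+b]≡b (x m) (x (m ℤ.+ + 1)))
    where
    a+[a+b]≡b : ∀ a b → a xor (a xor b) ≡ b
    a+[a+b]≡b = solve 2 (λ a b → a :+ (a :+ b) := b) refl
      where open 𝔽₂

  Δ∘step-odd : ∀ m → Δ (step y) (m ℤ.+ m ℤ.+ + 1) ≡ x m
  Δ∘step-odd m = trans
    (cong₂ _xor_ (step-odd m) (trans (cong (step y) (2m+1+1≡2[m+1] m)) (step-even (m ℤ.+ + 1))))
    ([a+b]+b≡a (x m) (x (m ℤ.+ + 1)))
    where
    [a+b]+b≡a : ∀ a b → (a xor b) xor b ≡ a
    [a+b]+b≡a = solve 2 (λ a b → (a :+ b) :+ b := a) refl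
      where open 𝔽₂

seed-dilation : IsDilation seed seed
seed-dilation = record { even = even ; odd = odd }
  where
  even : ∀ m → seed (m ℤ.+ m) ≡ seed m
  even (+ zero)  = refl
  even +[1+ k ]  = refl
  even -[1+ k ]  = refl
  odd : ∀ m → seed (m ℤ.+ m ℤ.+ + 1) ≡ false
  odd (+ zero)  = refl
  odd +[1+ k ]  = refl
  odd -[1+ k ]  = refl

cell-dilation : ∀ u → IsDilation (cell (u + u)) (cell u)
cell-dilation zero    = seed-dilation
cell-dilation (suc u) rewrite +-suc u u = step²-dilation (cell-dilation u)

∣i∣≤∣i+j∣+∣j∣ : ∀ i j → ∣ i ∣ ≤ ∣ i ℤ.+ j ∣ + ∣ j ∣
∣i∣≤∣i+j∣+∣j∣ i j = begin
  ∣ i ∣                          ≡⟨ cong ∣_∣ (i+j-j≡i i j) ⟨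
  ∣ i ℤ.+ j ℤ.- j ∣              ≤⟨ ∣i+j∣≤∣i∣+∣j∣ (i ℤ.+ j) (ℤ.- j) ⟩
  ∣ i ℤ.+ j ∣ + ∣ ℤ.- j ∣        ≡⟨ cong (_+_ ∣ i ℤ.+ j ∣) (∣-i∣≡∣i∣ j) ⟩
  ∣ i ℤ.+ j ∣ + ∣ j ∣            ∎
  where
  open ≤-Reasoning
  i+j-j≡i : ∀ i j → i ℤ.+ j ℤ.- j ≡ i
  i+j-j≡i = solve-∀

<-∣+∣ : ∀ t i j → ∣ j ∣ + t < ∣ i ∣ → t < ∣ i ℤ.+ j ∣
<-∣+∣ t i j j+t<i = +-cancelˡ-< (∣ j ∣) t (∣ i ℤ.+ j ∣) (begin-strict
  ∣ j ∣ + t             <⟨ j+t<i ⟩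
  ∣ i ∣                 ≤⟨ ∣i∣≤∣i+j∣+∣j∣ i j ⟩
  ∣ i ℤ.+ j ∣ + ∣ j ∣   ≡⟨ +-comm (∣ i ℤ.+ j ∣) (∣ j ∣) ⟩
  ∣ j ∣ + ∣ i ℤ.+ j ∣   ∎)
  where open ≤-Reasoning

cell-outside-light-cone : ∀ t m → t < ∣ m ∣ → cell t m ≡ false
cell-outside-light-cone zero    (+ zero) ()
cell-outside-light-cone zero    +[1+ k ] _ = refl
cell-outside-light-cone zero    -[1+ k ] _ = refl
cell-outside-light-cone (suc t) m t<m =
  cong₂ _xor_ (neighbour (ℤ.- + 1) t<m)
    (cong₂ _xor_ (cell-outside-light-cone t m (<-trans (n<1+n t) t<m)) (neighbour (+ 1) t<m))
  where
  neighbour : ∀ d → ∣ d ∣ + t < ∣ m ∣ → cell t (m ℤ.+ d) ≡ false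
  neighbour d d+t<m = cell-outside-light-cone t (m ℤ.+ d) (<-∣+∣ t m d d+t<m)

private
  -r+2r≡r : ∀ r → ℤ.- r ℤ.+ (r ℤ.+ r) ≡ r
  -r+2r≡r = solve-∀

ones : ℕ → (ℤ → Bool) → ℕ
ones r w = Σℤ (ℤ.- + r) (r + r) (bit ∘ w)

ones-suc : ∀ r w → ones (suc r) w ≡ bit (w -[1+ r ]) + Σℤ (ℤ.- + r) (suc (r + r)) (bit ∘ w)
ones-suc r w = trans (Σℤ-suc -[1+ r ] (r + suc r) (bit ∘ w))
  (cong₂ (λ a n → bit (w -[1+ r ]) + Σℤ a n (bit ∘ w)) (-[1+r]+1≡-r (+ r)) (+-suc r r))
  where
  -[1+r]+1≡-r : ∀ r → ℤ.- (+ 1 ℤ.+ r) ℤ.+ + 1 ≡ ℤ.- r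
  -[1+r]+1≡-r = solve-∀

ones-grow : ∀ r w → w -[1+ r ] ≡ false → w (+ r) ≡ false → ones (suc r) w ≡ ones r w
ones-grow r w left right = begin
  ones (suc r) w                                          ≡⟨ ones-suc r w ⟩
  bit (w -[1+ r ]) + Σℤ (ℤ.- + r) (suc (r + r)) (bit ∘ w) ≡⟨ cong₂ _+_ (cong bit left) (Σℤ-last (ℤ.- + r) (r + r) (bit ∘ w)) ⟩
  ones r w + bit (w (ℤ.- + r ℤ.+ + (r + r)))               ≡⟨ cong (λ m → ones r w + bit (w m)) (-r+2r≡r (+ r)) ⟩
  ones r w + bit (w (+ r))                                ≡⟨ cong (λ b → ones r w + bit b) right ⟩
  ones r w + 0                                            ≡⟨ +-identityʳ (ones r w) ⟩
  ones r w                                                ∎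
  where open ≡-Reasoning

ones-shift : ∀ r w → w (ℤ.- + r) ≡ false → w (+ r) ≡ false →
             Σℤ (ℤ.- + r) (r + r) (λ m → bit (w (m ℤ.+ + 1))) ≡ ones r w
ones-shift r w left right = begin
  Σℤ a (r + r) (λ m → f (m ℤ.+ + 1))       ≡⟨ cong (λ b → bit b + Σℤ a (r + r) (λ m → f (m ℤ.+ + 1))) left ⟨
  f a + Σℤ a (r + r) (λ m → f (m ℤ.+ + 1)) ≡⟨ Σℤ-slide a (r + r) f ⟩
  ones r w + f (a ℤ.+ + (r + r))           ≡⟨ cong (λ m → ones r w + f m) (-r+2r≡r (+ r)) ⟩
  ones r w + f (+ r)                       ≡⟨ cong (λ b → ones r w + bit b) right ⟩
  ones r w + 0                             ≡⟨ +-identityʳ (ones r w) ⟩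
  ones r w                                 ∎
  where
  open ≡-Reasoning
  a : ℤ
  a = ℤ.- + r
  f : ℤ → ℕ
  f = bit ∘ w

ones-pairs : ∀ r w (h : ℤ → ℕ) → (∀ m → bit (w (m ℤ.+ m)) + bit (w (m ℤ.+ m ℤ.+ + 1)) ≡ h m) →
             ones (r + r) w ≡ Σℤ (ℤ.- + r) (r + r) h
ones-pairs r w h pair = begin
  ones (r + r) w
    ≡⟨ cong (λ a → Σℤ a ((r + r) + (r + r)) (bit ∘ w)) (neg-distrib-+ (+ r) (+ r)) ⟩
  Σℤ (ℤ.- + r ℤ.+ ℤ.- + r) ((r + r) + (r + r)) (bit ∘ w)
    ≡⟨ Σℤ-pairs (ℤ.- + r) (r + r) (bit ∘ w) ⟩
  Σℤ (ℤ.- + r) (r + r) (λ m → bit (w (m ℤ.+ m)) + bit (w (m ℤ.+ m ℤ.+ + 1)))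
    ≡⟨ Σℤ-cong (ℤ.- + r) (r + r) pair ⟩
  Σℤ (ℤ.- + r) (r + r) h ∎
  where open ≡-Reasoning

ones-neighbours : ∀ r x w → x (ℤ.- + r) ≡ false → x (+ r) ≡ false →
                  (∀ m → bit (w (m ℤ.+ m)) + bit (w (m ℤ.+ m ℤ.+ + 1)) ≡ bit (x m) + bit (x (m ℤ.+ + 1))) →
                  ones (r + r) w ≡ ones r x + ones r x
ones-neighbours r x w left right pair = begin
  ones (r + r) w
    ≡⟨ ones-pairs r w _ pair ⟩
  Σℤ (ℤ.- + r) (r + r) (λ m → bit (x m) + bit (x (m ℤ.+ + 1)))
    ≡⟨ Σℤ-+ (ℤ.- + r) (r + r) (bit ∘ x) (λ m → bit (x (m ℤ.+ + 1))) ⟩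
  ones r x + Σℤ (ℤ.- + r) (r + r) (λ m → bit (x (m ℤ.+ + 1)))
    ≡⟨ cong (_+_ (ones r x)) (ones-shift r x left right) ⟩
  ones r x + ones r x ∎
  where open ≡-Reasoning

module _ {y x : ℤ → Bool} (dil : IsDilation y x) (r : ℕ) where
  open IsDilation dil

  ones-dilation : ones (r + r) y ≡ ones r x
  ones-dilation = ones-pairs r y (bit ∘ x) λ m →
    trans (cong₂ (λ a b → bit a + bit b) (even m) (odd m)) (+-identityʳ (bit (x m)))

  ones-step-dilation : ones (r + r) (step y) ≡ ones r x + ones r (Δ x)
  ones-step-dilation =
    trans (ones-pairs r (step y) _ λ m → cong₂ (λ a b → bit a + bit b) (step-even dil m) (step-odd dil m))
      (Σℤ-+ (ℤ.- + r) (r + r) (bit ∘ x) (bit ∘ Δ x))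

  module _ (left : x (ℤ.- + r) ≡ false) (right : x (+ r) ≡ false) where

    ones-Δ-dilation : ones (r + r) (Δ y) ≡ ones r x + ones r x
    ones-Δ-dilation = ones-neighbours r x (Δ y) left right λ m →
      cong₂ (λ a b → bit a + bit b) (Δ-even dil m) (Δ-odd dil m)

    ones-Δ-step-dilation : ones (r + r) (Δ (step y)) ≡ ones r x + ones r x
    ones-Δ-step-dilation = ones-neighbours r x (Δ (step y)) left right λ m →
      trans (cong₂ (λ a b → bit a + bit b) (Δ∘step-even dil m) (Δ∘step-odd dil m))
        (+-comm (bit (x (m ℤ.+ + 1))) (bit (x m)))

-- Δ (cell t) vanishes outside [-t-1, t], so D t counts every m with x m ≠ x (m + 1).
D : ℕ → ℕ
D t = ones (suc t) (Δ (cell t))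

X≡ones : ∀ t → X t ≡ ones (suc t) (cell t)
X≡ones t = begin
  X t                                                   ≡⟨ windowSum≡Σℤ t f ⟩
  Σℤ (ℤ.- + t) (suc (t + t)) f                           ≡⟨ cong (λ b → bit b + Σℤ (ℤ.- + t) (suc (t + t)) f) left ⟨
  bit (cell t -[1+ t ]) + Σℤ (ℤ.- + t) (suc (t + t)) f   ≡⟨ ones-suc t (cell t) ⟨
  ones (suc t) (cell t)                                 ∎
  where
  open ≡-Reasoning
  f : ℤ → ℕ
  f = bit ∘ cell t
  left : cell t -[1+ t ] ≡ false
  left = cell-outside-light-cone t -[1+ t ] (n<1+n t)

module _ (u : ℕ) where
  private
    x y : ℤ → Bool
    x = cell u
    y = cell (u + u)

    dil : IsDilation y x
    dil = cell-dilation u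

    x-left : x -[1+ u ] ≡ false
    x-left = cell-outside-light-cone u -[1+ u ] (n<1+n u)

    x-right : x (+ suc u) ≡ false
    x-right = cell-outside-light-cone u (+ suc u) (n<1+n u)

    y-outside : ∀ m → u + u < ∣ m ∣ → y m ≡ false
    y-outside = cell-outside-light-cone (u + u)

    ones-2[1+u] : ∀ w → ones (suc (suc (u + u))) w ≡ ones (suc u + suc u) w
    ones-2[1+u] w = cong (λ r → ones (suc r) w) (sym (+-suc u u))

  X-even : X (u + u) ≡ X u
  X-even = begin
    X (u + u)                     ≡⟨ X≡ones (u + u) ⟩
    ones (suc (u + u)) y          ≡⟨ ones-grow (suc (u + u)) y (y-outside _ (m<n⇒m<1+n (n<1+n _))) (y-outside _ (n<1+n _)) ⟨
    ones (suc (suc (u + u))) y    ≡⟨ ones-2[1+u] y ⟩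
    ones (suc u + suc u) y        ≡⟨ ones-dilation dil (suc u) ⟩
    ones (suc u) x                ≡⟨ X≡ones u ⟨
    X u                           ∎
    where open ≡-Reasoning

  X-odd : X (suc (u + u)) ≡ X u + D u
  X-odd = begin
    X (suc (u + u))                      ≡⟨ X≡ones (suc (u + u)) ⟩
    ones (suc (suc (u + u))) (step y)    ≡⟨ ones-2[1+u] (step y) ⟩
    ones (suc u + suc u) (step y)        ≡⟨ ones-step-dilation dil (suc u) ⟩
    ones (suc u) x + D u                 ≡⟨ cong (_+ D u) (X≡ones u) ⟨
    X u + D u                            ∎
    where open ≡-Reasoning

  D-even : D (u + u) ≡ X u + X u
  D-even = begin
    D (u + u)                         ≡⟨ ones-grow (suc (u + u)) (Δ y) left right ⟨
    ones (suc (suc (u + u))) (Δ y)    ≡⟨ ones-2[1+u] (Δ y) ⟩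
    ones (suc u + suc u) (Δ y)        ≡⟨ ones-Δ-dilation dil (suc u) x-left x-right ⟩
    ones (suc u) x + ones (suc u) x   ≡⟨ cong₂ _+_ (X≡ones u) (X≡ones u) ⟨
    X u + X u                         ∎
    where
    open ≡-Reasoning
    left : Δ y -[1+ suc (u + u) ] ≡ false
    left = cong₂ _xor_ (y-outside _ (m<n⇒m<1+n (n<1+n _))) (y-outside _ (n<1+n _))
    right : Δ y (+ suc (u + u)) ≡ false
    right = cong₂ _xor_ (y-outside _ (n<1+n _)) (y-outside _ (<-≤-trans (n<1+n _) (m≤m+n _ 1)))

  D-odd : D (suc (u + u)) ≡ X u + X u
  D-odd = begin
    D (suc (u + u))                          ≡⟨ ones-2[1+u] (Δ (step y)) ⟩
    ones (suc u + suc u) (Δ (step y))        ≡⟨ ones-Δ-step-dilation dil (suc u) x-left x-right ⟩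
    ones (suc u) x + ones (suc u) x          ≡⟨ cong₂ _+_ (X≡ones u) (X≡ones u) ⟨
    X u + X u                                ∎
    where open ≡-Reasoning

T : ℕ → ℕ
T n = Σ (2 ^ n) D

S≡Σ : ∀ n → S n ≡ Σ (2 ^ n) X
S≡Σ n = cong sum (map-applyUpTo id X (2 ^ n))

Σ-2^suc : ∀ n f → Σ (2 ^ suc n) f ≡ Σ (2 ^ n) (λ k → f (k + k) + f (suc (k + k)))
Σ-2^suc n f = trans (cong (λ m → Σ (2 ^ n + m) f) (+-identityʳ (2 ^ n))) (Σ-pairs (2 ^ n) f)

S-suc : ∀ n → S (suc n) ≡ S n + (S n + T n)
S-suc n = begin
  S (suc n)                                         ≡⟨ S≡Σ (suc n) ⟩
  Σ (2 ^ suc n) X                                   ≡⟨ Σ-2^suc n X ⟩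
  Σ (2 ^ n) (λ k → X (k + k) + X (suc (k + k)))     ≡⟨ Σ-cong (2 ^ n) (λ k → cong₂ _+_ (X-even k) (X-odd k)) ⟩
  Σ (2 ^ n) (λ k → X k + (X k + D k))               ≡⟨ Σ-+ (2 ^ n) X (λ k → X k + D k) ⟩
  Σ (2 ^ n) X + Σ (2 ^ n) (λ k → X k + D k)         ≡⟨ cong (_+_ (Σ (2 ^ n) X)) (Σ-+ (2 ^ n) X D) ⟩
  Σ (2 ^ n) X + (Σ (2 ^ n) X + T n)                 ≡⟨ cong (λ s → s + (s + T n)) (S≡Σ n) ⟨
  S n + (S n + T n)                                 ∎
  where open ≡-Reasoning

T-suc : ∀ n → T (suc n) ≡ (S n + S n) + (S n + S n)
T-suc n = begin
  T (suc n)                                                   ≡⟨ Σ-2^suc n D ⟩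
  Σ (2 ^ n) (λ k → D (k + k) + D (suc (k + k)))               ≡⟨ Σ-cong (2 ^ n) (λ k → cong₂ _+_ (D-even k) (D-odd k)) ⟩
  Σ (2 ^ n) (λ k → (X k + X k) + (X k + X k))                 ≡⟨ Σ-+ (2 ^ n) (λ k → X k + X k) (λ k → X k + X k) ⟩
  Σ (2 ^ n) (λ k → X k + X k) + Σ (2 ^ n) (λ k → X k + X k)   ≡⟨ cong₂ _+_ (Σ-+ (2 ^ n) X X) (Σ-+ (2 ^ n) X X) ⟩
  (Σ (2 ^ n) X + Σ (2 ^ n) X) + (Σ (2 ^ n) X + Σ (2 ^ n) X)   ≡⟨ cong (λ s → (s + s) + (s + s)) (S≡Σ n) ⟨
  (S n + S n) + (S n + S n)                                   ∎
  where open ≡-Reasoning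

S-recurrence : ∀ n → S (suc (suc n)) ≡ 2 * S (suc n) + 4 * S n
S-recurrence n = begin
  S (suc (suc n))                                       ≡⟨ S-suc (suc n) ⟩
  S (suc n) + (S (suc n) + T (suc n))                   ≡⟨ cong (λ t → S (suc n) + (S (suc n) + t)) (T-suc n) ⟩
  S (suc n) + (S (suc n) + ((S n + S n) + (S n + S n))) ≡⟨ collect (S (suc n)) (S n) ⟩
  2 * S (suc n) + 4 * S n                               ∎
  where
  open ≡-Reasoning
  collect : ∀ a b → a + (a + ((b + b) + (b + b))) ≡ 2 * a + 4 * b
  collect = ℕ-solve-∀

2^n*fib[n+2]-unique : (s : ℕ → ℕ) → s 0 ≡ 1 → s 1 ≡ 4 →
                      (∀ n → s (suc (suc n)) ≡ 2 * s (suc n) + 4 * s n) →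
                      ∀ n → s n ≡ 2 ^ n * fib (n + 2)
2^n*fib[n+2]-unique s s₀ s₁ rec n =
  trans (proj₁ (consecutive n)) (cong (λ k → 2 ^ n * fib k) (+-comm 2 n))
  where
  consecutive : ∀ n → s n ≡ 2 ^ n * fib (suc (suc n)) × s (suc n) ≡ 2 ^ suc n * fib (suc (suc (suc n)))
  consecutive zero    = s₀ , s₁
  consecutive (suc n) with consecutive n
  ... | sₙ , sₙ₊₁ = sₙ₊₁ , (begin
    s (suc (suc n))                                                     ≡⟨ rec n ⟩
    2 * s (suc n) + 4 * s n                                             ≡⟨ cong₂ (λ a b → 2 * a + 4 * b) sₙ₊₁ sₙ ⟩
    2 * (2 ^ suc n * fib (suc (suc (suc n)))) + 4 * (2 ^ n * fib (suc (suc n))) ≡⟨ fib-step (2 ^ n) _ _ ⟩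
    2 ^ suc (suc n) * fib (suc (suc (suc (suc n))))                     ∎)
    where
    open ≡-Reasoning
    fib-step : ∀ p a b → 2 * (2 * p * a) + 4 * (p * b) ≡ 2 * (2 * p) * (a + b)
    fib-step = ℕ-solve-∀

mainTheorem5 : (n : ℕ) → S n ≡ 2 ^ n * fib (n + 2)
mainTheorem5 = 2^n*fib[n+2]-unique S refl refl S-recurrence
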